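{- Let $T$ be a non-deterministic register transducer with $k$ registers. Then for every $X\subseteq\mathcal{D}$ with $|X|\geq 2k+3$ and $d_0\in X$, $T$ is functional if and only if $[\![T]\!]\cap\big((\Sigma\times X)^\omega\times(\Gamma\times X)^\omega\big)$ is functional (i.e. is a partial function).
   Context: Fix finite alphabets $\Sigma,\Gamma$, a countably infinite set $\mathcal{D}$ of data values and a distinguished $d_0\in\mathcal{D}$. A test over a finite register set $R$ is a Boolean combination of $\top,\bot,r^{=},r^{\neq}$ ($r\in R$); for $\tau:R\to\mathcal{D}$ and $d\in\mathcal{D}$, $\tau,d\models r^{=}$ iff $\tau(r)=d$, $\tau,d\models r^{\neq}$ iff $\tau(r)\neq d$. A non-deterministic register transducer (NRT) is $T=(Q,R,i_0,F,\Delta)$ with finite states $Q$, initial $i_0$, accepting $F\subseteq Q$, finite register set $R$ ($k=|R|$), and finite $\Delta\subseteq Q\times\Sigma\times\mathrm{Tests}_R\times2^R\times(\Gamma\times R)^*\times Q$. From configuration $(q,\tau)$, reading $(\sigma,d)$, a transition $(q,\sigma,\phi,\mathrm{asgn},o,q')$ with $\tau,d\models\phi$ leads to $(q',\tau')$ with $\tau'(r)=d$ if $r\in\mathrm{asgn}$ and $\tau'(r)=\tau(r)$ otherwise, outputting $(\gamma_1,\tau'(r_1))\cdots(\gamma_m,\tau'(r_m))$ where $o=(\gamma_1,r_1)\cdots(\gamma_m,r_m)$. An accepting run starts in $i_0$ with all registers equal to $d_0$ and visits $F$ infinitely often; standing assumption: accepting runs produce infinite outputs. $[\![T]\!]\subseteq(\Sigma\times\mathcal{D})^\omega\times(\Gamma\times\mathcal{D})^\omega$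 is the set of pairs (input, output) of accepting runs. $T$ is functional if $[\![T]\!]$ is a partial function. -}

module Defs where

open import Data.Nat using (ℕ; zero; suc; _+_; _≤_; _≟_)
open import Data.Fin using (Fin; toℕ)
open import Data.Bool using (Bool; true; false; not; _∧_; _∨_; if_then_else_; T)
open import Data.List using (List; length; map; lookup)
open import Data.List.Membership.Propositional using (_∈_)
open import Data.Product using (Σ; ∃; _×_; _,_; proj₁; proj₂)
open import Relation.Binary.PropositionalEquality using (_≡_)
open import Relation.Nullary.Decidable using (⌊_⌋)

𝒟 : Set
𝒟 = ℕ

-- Input alphabet Σ = Fin s, output alphabet Γ = Fin g (arbitrary finite alphabets).
-- Registers R = Fin k.

data Test (k : ℕ) : Set where
  tt ff     : Test k
  req rneq  : Fin k → Test k
  tnot      : Test k → Test k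
  tand tor  : Test k → Test k → Test k

sat : ∀ {k} → Test k → (Fin k → 𝒟) → 𝒟 → Bool
sat tt         τ d = true
sat ff         τ d = false
sat (req r)    τ d = ⌊ τ r ≟ d ⌋
sat (rneq r)   τ d = not ⌊ τ r ≟ d ⌋
sat (tnot φ)   τ d = not (sat φ τ d)
sat (tand φ ψ) τ d = sat φ τ d ∧ sat ψ τ d
sat (tor φ ψ)  τ d = sat φ τ d ∨ sat ψ τ d

record Trans (nQ k s g : ℕ) : Set where
  field
    src  : Fin nQ
    lab  : Fin s
    test : Test k
    asgn : Fin k → Bool
    out  : List (Fin g × Fin k)
    tgt  : Fin nQ

record NRT (s g : ℕ) : Set where
  field
    nQ  : ℕ
    k   : ℕ
    i₀  : Fin nQ
    F   : Fin nQ → Bool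
    Δ   : List (Trans nQ k s g)

InWord : ℕ → Set
InWord s = ℕ → Fin s × 𝒟

OutWord : ℕ → Set
OutWord g = ℕ → Fin g × 𝒟

module _ {s g : ℕ} (d₀ : 𝒟) (A : NRT s g) where
  open NRT A

  record Run : Set where
    field
      q : ℕ → Fin nQ
      τ : ℕ → Fin k → 𝒟
      δ : ℕ → Trans nQ k s g

  open Run public

  -- output list of step i (evaluated on the updated valuation τ (suc i))
  stepOut : Run → ℕ → List (Fin g × 𝒟)
  stepOut ρ i = map (λ p → proj₁ p , τ ρ (suc i) (proj₂ p)) (Trans.out (δ ρ i))

  pos : Run → ℕ → ℕ
  pos ρ zero    = zero
  pos ρ (suc i) = pos ρ i + length (stepOut ρ i)

  IsAcceptingRun : Run → InWord s → Set
  IsAcceptingRun ρ u =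
      (q ρ 0 ≡ i₀)
    × (∀ r → τ ρ 0 r ≡ d₀)
    × (∀ i → (δ ρ i ∈ Δ)
           × (Trans.src (δ ρ i) ≡ q ρ i)
           × (Trans.lab (δ ρ i) ≡ proj₁ (u i))
           × T (sat (Trans.test (δ ρ i)) (τ ρ i) (proj₂ (u i)))
           × (∀ r → τ ρ (suc i) r ≡ (if Trans.asgn (δ ρ i) r then proj₂ (u i) else τ ρ i r))
           × (Trans.tgt (δ ρ i) ≡ q ρ (suc i)))
    × (∀ n → Σ ℕ λ m → (n ≤ m) × T (F (q ρ m)))

  InfiniteOutput : Run → Set
  InfiniteOutput ρ = ∀ n → Σ ℕ λ i → n ≤ pos ρ i

  Produces : Run → OutWord g → Set
  Produces ρ w =
      InfiniteOutput ρ
    × (∀ i (j : Fin (length (stepOut ρ i))) → w (pos ρ i + toℕ j) ≡ lookup (stepOut ρ i) j)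

  StandingAssumption : Set
  StandingAssumption = ∀ ρ u → IsAcceptingRun ρ u → InfiniteOutput ρ

  ⟦_⟧ : InWord s → OutWord g → Set
  ⟦_⟧ u w = Σ Run λ ρ → IsAcceptingRun ρ u × Produces ρ w

Functional : ∀ {s g} → (InWord s → OutWord g → Set) → Set
Functional Rel = ∀ u w w′ → Rel u w → Rel u w′ → ∀ n → w n ≡ w′ n

Restrict : ∀ {s g} → (𝒟 → Set) → (InWord s → OutWord g → Set) → InWord s → OutWord g → Set
Restrict X Rel u w = (∀ i → X (proj₂ (u i))) × (∀ i → X (proj₂ (w i))) × Rel u w

AtLeast : ℕ → (𝒟 → Set) → Set
AtLeast n X = Σ (Fin n → 𝒟) λ f → (∀ i j → f i ≡ f j → i ≡ j) × (∀ i → X (f i))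

module Submission where

-- Only "restricted functional ⇒ functional" needs an argument.  Take two
-- accepting runs ρ₁, ρ₂ on the same input u, with outputs w₁, w₂, and a
-- position n; put e = the data value of w₁ n.  We rename data values
-- step by step: h t is an injection of the values tracked at time t (the
-- registers of both runs, and e) into X, h (suc t) agrees with h t on them,
-- and the value read at step t is sent to its old image if it is tracked
-- and to a fresh element of X otherwise (there are at most 2k + 1 images to
-- avoid).  Tests only see equalities between the read value and the
-- registers, so the renamed runs are accepting runs on the renamed input,
-- producing the renamed outputs, all inside X.  Restricted functionality
-- makes the renamed outputs agree at n; since e keeps a single image and h
-- is injective on tracked values, w₁ n = w₂ n.

open import Defs
open import Data.Nat using (ℕ; _+_; _*_)
open import Function.Bundles using (_⇔_)

open import Data.Nat as ℕ using (zero; suc; _∸_; _≤_; _<_; _≤′_; ≤′-reflexive; ≤′-step; z≤n; s≤s)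
open import Data.Nat.Properties
open import Data.Nat.Tactic.RingSolver using (solve-∀)
open import Data.Fin as Fin using (Fin; toℕ)
open import Data.Fin.Properties using (any?; injective⇒≤; toℕ-cast; toℕ<n; toℕ-fromℕ<)
open import Data.Bool using (true; false; not; _∧_; _∨_; if_then_else_; T)
open import Data.List using (List; []; _∷_; length; map; lookup; tabulate; _++_)
open import Data.List.Properties using (length-++; length-map; length-tabulate)
open import Data.List.Membership.Propositional using (_∈_; _∉_)
open import Data.List.Membership.Propositional.Properties using (∈-map⁺; ∈-++⁺ˡ; ∈-++⁺ʳ; ∈-tabulate⁺)
open import Data.List.Membership.DecPropositional ℕ._≟_ using (_∈?_)
open import Data.List.Relation.Unary.Any using (here; there; index)
open import Data.List.Relation.Unary.Any.Properties using (lookup-index)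
open import Data.Product using (Σ; ∃; _×_; _,_; proj₁; proj₂)
open import Data.Sum using (_⊎_; inj₁; inj₂)
open import Function.Bundles using (mk⇔)
open import Relation.Binary.Definitions using (tri<; tri≈; tri>)
open import Relation.Binary.PropositionalEquality
open import Relation.Nullary using (Dec; yes; no; contradiction)
open import Relation.Nullary.Decidable using (isYes; isYes≗does; does-⇔; decidable-stable; ¬?; _⊎-dec_)

-- An injective family of n values cannot lie inside a list shorter than n:
-- the positions of the values in the list would inject Fin n into a
-- smaller Fin.  This is the source of fresh data values in X.
avoid : ∀ {n} (f : Fin n → ℕ) → (∀ i j → f i ≡ f j → i ≡ j)
      → (L : List ℕ) → length L < n → ∃ λ i → f i ∉ L
avoid f f-injective L |L|<n with any? (λ i → ¬? (f i ∈? L))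
... | yes outside = outside
... | no  none    = contradiction (injective⇒≤ position-injective) (<⇒≱ |L|<n)
  where
  member : ∀ i → f i ∈ L
  member i = decidable-stable (f i ∈? L) (λ f-i∉L → none (i , f-i∉L))

  position-injective : ∀ {i j} → index (member i) ≡ index (member j) → i ≡ j
  position-injective {i} {j} same = f-injective i j (begin
    f i                        ≡⟨ lookup-index (member i) ⟩
    lookup L (index (member i)) ≡⟨ cong (lookup L) same ⟩
    lookup L (index (member j)) ≡⟨ lookup-index (member j) ⟨
    f j                        ∎)
    where open ≡-Reasoning

isYes-⇔ : ∀ {P Q : Set} → P ⇔ Q → (p? : Dec P) (q? : Dec Q) → isYes p? ≡ isYes q?
isYes-⇔ P⇔Q p? q? = trans (isYes≗does p?) (trans (does-⇔ P⇔Q p? q?) (sym (isYes≗does q?)))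

-- A test only asks which registers hold the current data value, so two
-- (valuation, value) pairs with the same equality pattern satisfy the same
-- tests.  This is what lets a renaming of data values preserve runs.
sat-pattern : ∀ {k} (φ : Test k) {τ τ′ : Fin k → 𝒟} {d d′ : 𝒟}
            → (∀ r → (τ r ≡ d) ⇔ (τ′ r ≡ d′)) → sat φ τ d ≡ sat φ τ′ d′
sat-pattern tt         same = refl
sat-pattern ff         same = refl
sat-pattern (req r)    same = isYes-⇔ (same r) _ _
sat-pattern (rneq r)   same = cong not (isYes-⇔ (same r) _ _)
sat-pattern (tnot φ)   same = cong not (sat-pattern φ same)
sat-pattern (tand φ ψ) same = cong₂ _∧_ (sat-pattern φ same) (sat-pattern ψ same)
sat-pattern (tor φ ψ)  same = cong₂ _∨_ (sat-pattern φ same) (sat-pattern ψ same)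

-- Entry j of  map f xs  is f applied to the entry of xs at the same
-- numerical position (the two index types differ, so positions are compared
-- through toℕ).
lookup-map-at : ∀ {A B : Set} (f : A → B) (xs : List A)
                (j : Fin (length (map f xs))) (i : Fin (length xs))
              → toℕ j ≡ toℕ i → lookup (map f xs) j ≡ f (lookup xs i)
lookup-map-at f (x ∷ xs) Fin.zero    Fin.zero    _    = refl
lookup-map-at f (x ∷ xs) (Fin.suc j) (Fin.suc i) j≡i = lookup-map-at f xs j i (suc-injective j≡i)

register-update : ∀ {s g} {d₀ : 𝒟} {A : NRT s g} {ρ : Run d₀ A} {u : InWord s}
                → IsAcceptingRun d₀ A ρ u
                → ∀ t r → τ ρ (suc t) r ≡ τ ρ t r ⊎ τ ρ (suc t) r ≡ proj₂ (u t)
register-update {ρ = ρ} (_ , _ , steps , _) t r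
  with Trans.asgn (δ ρ t) r | proj₁ (proj₂ (proj₂ (proj₂ (proj₂ (steps t))))) r
... | true  | assigned = inj₂ assigned
... | false | kept     = inj₁ kept

module OutputPositions {s g : ℕ} (d₀ : 𝒟) (A : NRT s g) (ρ : Run d₀ A) where

  width : ℕ → ℕ
  width t = length (stepOut d₀ A ρ t)

  pos-mono : ∀ {t t′} → t ≤′ t′ → pos d₀ A ρ t ≤ pos d₀ A ρ t′
  pos-mono (≤′-reflexive refl) = ≤-refl
  pos-mono (≤′-step t≤t′)      = ≤-trans (pos-mono t≤t′) (m≤m+n _ _)

  slot-before : ∀ {t t′} → t < t′ → (j : Fin (width t)) → pos d₀ A ρ t + toℕ j < pos d₀ A ρ t′
  slot-before {t} t<t′ j = <-≤-trans (+-monoʳ-< (pos d₀ A ρ t) (toℕ<n j)) (pos-mono (≤⇒≤′ t<t′))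

  slot-unique : ∀ {t t′} (j : Fin (width t)) (j′ : Fin (width t′))
              → pos d₀ A ρ t + toℕ j ≡ pos d₀ A ρ t′ + toℕ j′ → t ≡ t′
  slot-unique {t} {t′} j j′ same with <-cmp t t′
  ... | tri< t<t′ _ _ = contradiction (subst (pos d₀ A ρ t′ ≤_) (sym same) (m≤m+n _ _)) (<⇒≱ (slot-before t<t′ j))
  ... | tri≈ _ t≡t′ _ = t≡t′
  ... | tri> _ _ t′<t = contradiction (subst (pos d₀ A ρ t ≤_) same (m≤m+n _ _)) (<⇒≱ (slot-before t′<t j′))

  Slot : ℕ → Set
  Slot m = Σ ℕ λ t → Σ (Fin (width t)) λ j → pos d₀ A ρ t + toℕ j ≡ m

  slot-below : ∀ N m → m < pos d₀ A ρ N → Slot m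
  slot-below (suc N) m m<pos with m ℕ.<? pos d₀ A ρ N
  ... | yes earlier = slot-below N m earlier
  ... | no  later   = N , Fin.fromℕ< offset<width , trans (cong (pos d₀ A ρ N +_) (toℕ-fromℕ< offset<width)) (m+[n∸m]≡n pos≤m)
    where
    pos≤m : pos d₀ A ρ N ≤ m
    pos≤m = ≮⇒≥ later
    offset<width : m ∸ pos d₀ A ρ N < width N
    offset<width = +-cancelˡ-< (pos d₀ A ρ N) _ _ (subst (_< pos d₀ A ρ (suc N)) (sym (m+[n∸m]≡n pos≤m)) m<pos)

  locate : InfiniteOutput d₀ A ρ → ∀ m → Slot m
  locate infinite m = slot-below (proj₁ (infinite (suc m))) m (proj₂ (infinite (suc m)))

  step-of : InfiniteOutput d₀ A ρ → ℕ → ℕ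
  step-of infinite m = proj₁ (locate infinite m)

  step-of-slot : ∀ infinite t (j : Fin (width t)) → step-of infinite (pos d₀ A ρ t + toℕ j) ≡ t
  step-of-slot infinite t j with locate infinite (pos d₀ A ρ t + toℕ j)
  ... | _ , j′ , written = slot-unique j′ j written

  output-in-register : ∀ w (produces : Produces d₀ A ρ w) m
                     → ∃ λ r → proj₂ (w m) ≡ τ ρ (suc (step-of (proj₁ produces) m)) r
  output-in-register w (infinite , letters) m with locate infinite m
  ... | t , j , refl = proj₂ (lookup out i) , cong proj₂ (trans (letters t j)
                         (lookup-map-at (λ p → proj₁ p , τ ρ (suc t) (proj₂ p)) out j i (sym (toℕ-cast _ j))))
    where
    out : List (Fin g × Fin (NRT.k A))
    out = Trans.out (δ ρ t)
    i : Fin (length out)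
    i = Fin.cast (length-map _ out) j

-- Renaming a run along a time-indexed renaming h: the registers at time t
-- are renamed by h t, and the value read at step t by h (suc t), the
-- renaming in force once it has been stored.
module Renaming {s g : ℕ} (d₀ : 𝒟) (A : NRT s g) (h : ℕ → 𝒟 → 𝒟) where
  open OutputPositions d₀ A

  renameRun : Run d₀ A → Run d₀ A
  renameRun ρ = record { q = q ρ ; τ = λ t r → h t (τ ρ t r) ; δ = δ ρ }

  renameInput : InWord s → InWord s
  renameInput u t = proj₁ (u t) , h (suc t) (proj₂ (u t))

  renameLetter : (𝒟 → 𝒟) → Fin g × 𝒟 → Fin g × 𝒟
  renameLetter f (γ , d) = γ , f d

  renameOutput : (ρ : Run d₀ A) → InfiniteOutput d₀ A ρ → OutWord g → OutWord g
  renameOutput ρ infinite w m = renameLetter (h (suc (step-of ρ infinite m))) (w m)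

  LegalStep : Run d₀ A → InWord s → ℕ → Set
  LegalStep ρ u t =
      (δ ρ t ∈ NRT.Δ A)
    × (Trans.src (δ ρ t) ≡ q ρ t)
    × (Trans.lab (δ ρ t) ≡ proj₁ (u t))
    × T (sat (Trans.test (δ ρ t)) (τ ρ t) (proj₂ (u t)))
    × (∀ r → τ ρ (suc t) r ≡ (if Trans.asgn (δ ρ t) r then proj₂ (u t) else τ ρ t r))
    × (Trans.tgt (δ ρ t) ≡ q ρ (suc t))

  record Compatible (ρ : Run d₀ A) (u : InWord s) : Set where
    field
      fixes-d₀  : h 0 d₀ ≡ d₀
      persists  : ∀ t r → h (suc t) (τ ρ t r) ≡ h t (τ ρ t r)
      separates : ∀ t r → h (suc t) (τ ρ t r) ≡ h (suc t) (proj₂ (u t)) → τ ρ t r ≡ proj₂ (u t)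

  -- A compatible renaming maps accepting runs to accepting runs: the same
  -- transitions apply because tests see the same equality pattern.
  renameRun-accepting : ∀ {ρ u} → Compatible ρ u → IsAcceptingRun d₀ A ρ u
                      → IsAcceptingRun d₀ A (renameRun ρ) (renameInput u)
  renameRun-accepting {ρ} {u} compatible (starts , initial , steps , büchi) =
    starts , (λ r → trans (cong (h 0) (initial r)) fixes-d₀) , renamed-step , büchi
    where
    open Compatible compatible

    renamed-step : ∀ t → LegalStep (renameRun ρ) (renameInput u) t
    renamed-step t with steps t
    ... | in-Δ , source , label , test , update , target = in-Δ , source , label , renamed-test , renamed-update , target
      where
      d : 𝒟
      d = proj₂ (u t)

      same-pattern : ∀ r → (τ ρ t r ≡ d) ⇔ (h t (τ ρ t r) ≡ h (suc t) d)
      same-pattern r = mk⇔ (λ τ≡d → trans (sym (persists t r)) (cong (h (suc t)) τ≡d))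
                           (λ hτ≡hd → separates t r (trans (persists t r) hτ≡hd))

      renamed-test : T (sat (Trans.test (δ ρ t)) (τ (renameRun ρ) t) (h (suc t) d))
      renamed-test = subst T (sat-pattern (Trans.test (δ ρ t)) same-pattern) test

      renamed-update : ∀ r → h (suc t) (τ ρ (suc t) r)
                           ≡ (if Trans.asgn (δ ρ t) r then h (suc t) d else h t (τ ρ t r))
      renamed-update r with Trans.asgn (δ ρ t) r | update r
      ... | true  | assigned = cong (h (suc t)) assigned
      ... | false | kept     = trans (cong (h (suc t)) kept) (persists t r)

  width-rename : ∀ ρ t → width (renameRun ρ) t ≡ width ρ t
  width-rename ρ t = trans (length-map _ (Trans.out (δ ρ t))) (sym (length-map _ (Trans.out (δ ρ t))))

  pos-rename : ∀ ρ t → pos d₀ A (renameRun ρ) t ≡ pos d₀ A ρ t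
  pos-rename ρ zero    = refl
  pos-rename ρ (suc t) = cong₂ _+_ (pos-rename ρ t) (width-rename ρ t)

  renameRun-produces : ∀ {ρ} w (produces : Produces d₀ A ρ w)
                     → Produces d₀ A (renameRun ρ) (renameOutput ρ (proj₁ produces) w)
  renameRun-produces {ρ} w (infinite , letters) = renamed-infinite , renamed-letters
    where
    ρ′ : Run d₀ A
    ρ′ = renameRun ρ

    renamed-infinite : InfiniteOutput d₀ A ρ′
    renamed-infinite n = proj₁ (infinite n) , subst (n ≤_) (sym (pos-rename ρ (proj₁ (infinite n)))) (proj₂ (infinite n))

    renamed-letters : ∀ t (j : Fin (width ρ′ t))
                    → renameOutput ρ infinite w (pos d₀ A ρ′ t + toℕ j) ≡ lookup (stepOut d₀ A ρ′ t) j
    renamed-letters t j = begin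
      renameOutput ρ infinite w (pos d₀ A ρ′ t + toℕ j)
        ≡⟨ cong (renameOutput ρ infinite w) same-position ⟩
      renameLetter (h (suc (step-of ρ infinite m))) (w m)
        ≡⟨ cong (λ t′ → renameLetter (h (suc t′)) (w m)) (step-of-slot ρ infinite t j₀) ⟩
      renameLetter (h (suc t)) (w m)
        ≡⟨ cong (renameLetter (h (suc t))) (letters t j₀) ⟩
      renameLetter (h (suc t)) (lookup (stepOut d₀ A ρ t) j₀)
        ≡⟨ cong (renameLetter (h (suc t))) (lookup-map-at _ out j₀ i (trans (toℕ-cast _ j) (sym (toℕ-cast _ j)))) ⟩
      renameLetter (h (suc t)) (proj₁ (lookup out i) , τ ρ (suc t) (proj₂ (lookup out i)))
        ≡⟨ lookup-map-at _ out j i (sym (toℕ-cast _ j)) ⟨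
      lookup (stepOut d₀ A ρ′ t) j ∎
      where
      open ≡-Reasoning
      out : List (Fin g × Fin (NRT.k A))
      out = Trans.out (δ ρ t)
      j₀ : Fin (width ρ t)
      j₀ = Fin.cast (width-rename ρ t) j
      i : Fin (length out)
      i = Fin.cast (length-map _ out) j
      m : ℕ
      m = pos d₀ A ρ t + toℕ j₀
      same-position : pos d₀ A ρ′ t + toℕ j ≡ m
      same-position = cong₂ _+_ (pos-rename ρ t) (sym (toℕ-cast _ j))

record EmbedsInto (X P : 𝒟 → Set) (f : 𝒟 → 𝒟) : Set where
  field
    into      : ∀ {x} → P x → X (f x)
    injective : ∀ {x y} → P x → P y → f x ≡ f y → x ≡ y

open EmbedsInto

module TwoRuns {s g : ℕ} (d₀ : 𝒟) (A : NRT s g) (X : 𝒟 → Set) (d₀∈X : X d₀)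
  (fresh : ∀ (L : List 𝒟) → length L ≤ 2 * NRT.k A + 1 → ∃ λ y → X y × y ∉ L)
  {u : InWord s} {ρ₁ ρ₂ : Run d₀ A}
  (accepting₁ : IsAcceptingRun d₀ A ρ₁ u) (accepting₂ : IsAcceptingRun d₀ A ρ₂ u)
  (e : 𝒟) where
  open NRT A using (k)
  open OutputPositions d₀ A using (step-of; output-in-register)

  Tracked : ℕ → 𝒟 → Set
  Tracked t x = x ≡ e ⊎ (∃ λ r → τ ρ₁ t r ≡ x) ⊎ (∃ λ r → τ ρ₂ t r ≡ x)

  tracked? : ∀ t x → Dec (Tracked t x)
  tracked? t x = (x ℕ.≟ e) ⊎-dec (any? (λ r → τ ρ₁ t r ℕ.≟ x) ⊎-dec any? (λ r → τ ρ₂ t r ℕ.≟ x))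

  Tracked⁺ : ℕ → 𝒟 → Set
  Tracked⁺ t x = Tracked t x ⊎ x ≡ proj₂ (u t)

  trackedList : ℕ → List 𝒟
  trackedList t = e ∷ tabulate (τ ρ₁ t) ++ tabulate (τ ρ₂ t)

  trackedList-complete : ∀ {t x} → Tracked t x → x ∈ trackedList t
  trackedList-complete     (inj₁ refl)              = here refl
  trackedList-complete     (inj₂ (inj₁ (r , refl))) = there (∈-++⁺ˡ (∈-tabulate⁺ r))
  trackedList-complete {t} (inj₂ (inj₂ (r , refl))) = there (∈-++⁺ʳ (tabulate (τ ρ₁ t)) (∈-tabulate⁺ r))

  trackedList-length : ∀ t → length (trackedList t) ≡ 2 * k + 1
  trackedList-length t = begin
    suc (length (tabulate (τ ρ₁ t) ++ tabulate (τ ρ₂ t)))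
      ≡⟨ cong suc (length-++ (tabulate (τ ρ₁ t))) ⟩
    suc (length (tabulate (τ ρ₁ t)) + length (tabulate (τ ρ₂ t)))
      ≡⟨ cong suc (cong₂ _+_ (length-tabulate (τ ρ₁ t)) (length-tabulate (τ ρ₂ t))) ⟩
    suc (k + k)
      ≡⟨ two-copies k ⟩
    2 * k + 1 ∎
    where
    open ≡-Reasoning
    two-copies : ∀ n → suc (n + n) ≡ 2 * n + 1
    two-copies = solve-∀

  outside-image : (f : 𝒟 → 𝒟) → ∀ t → ∃ λ y → X y × y ∉ map f (trackedList t)
  outside-image f t = fresh (map f (trackedList t)) (≤-reflexive (trans (length-map f (trackedList t)) (trackedList-length t)))

  other-than-d₀ : ∃ λ y → X y × y ∉ d₀ ∷ []
  other-than-d₀ = fresh (d₀ ∷ []) (m≤n+m 1 (2 * k))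

  h : ℕ → 𝒟 → 𝒟
  h zero x with x ℕ.≟ d₀
  ... | yes _ = d₀
  ... | no  _ = proj₁ other-than-d₀
  h (suc t) x with tracked? t x
  ... | yes _ = h t x
  ... | no  _ = proj₁ (outside-image (h t) t)

  h-fixes-d₀ : h 0 d₀ ≡ d₀
  h-fixes-d₀ with d₀ ℕ.≟ d₀
  ... | yes _    = refl
  ... | no  d₀≢d₀ = contradiction refl d₀≢d₀

  persists : ∀ {t x} → Tracked t x → h (suc t) x ≡ h t x
  persists {t} {x} tracked with tracked? t x
  ... | yes _         = refl
  ... | no  untracked = contradiction tracked untracked

  -- e is tracked forever, so its image never changes.
  e-pinned : ∀ t → h t e ≡ h 0 e
  e-pinned zero    = refl
  e-pinned (suc t) = trans (persists (inj₁ refl)) (e-pinned t)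

  tracked-initially : ∀ {x} → Tracked 0 x → x ≡ d₀ ⊎ x ≡ e
  tracked-initially (inj₁ x≡e)              = inj₂ x≡e
  tracked-initially (inj₂ (inj₁ (r , refl))) = inj₁ (proj₁ (proj₂ accepting₁) r)
  tracked-initially (inj₂ (inj₂ (r , refl))) = inj₁ (proj₁ (proj₂ accepting₂) r)

  tracked-step : ∀ {t x} → Tracked (suc t) x → Tracked⁺ t x
  tracked-step (inj₁ x≡e) = inj₁ (inj₁ x≡e)
  tracked-step {t} (inj₂ (inj₁ (r , refl))) with register-update {A = A} accepting₁ t r
  ... | inj₁ kept     = inj₁ (inj₂ (inj₁ (r , sym kept)))
  ... | inj₂ assigned = inj₂ assigned
  tracked-step {t} (inj₂ (inj₂ (r , refl))) with register-update {A = A} accepting₂ t r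
  ... | inj₁ kept     = inj₁ (inj₂ (inj₂ (r , sym kept)))
  ... | inj₂ assigned = inj₂ assigned

  embeds-initially : EmbedsInto X (Tracked 0) (h 0)
  into embeds-initially {x} _ with x ℕ.≟ d₀
  ... | yes _ = d₀∈X
  ... | no  _ = proj₁ (proj₂ other-than-d₀)
  injective embeds-initially {x} {y} x-tracked y-tracked hx≡hy with x ℕ.≟ d₀ | y ℕ.≟ d₀
  ... | yes x≡d₀ | yes y≡d₀ = trans x≡d₀ (sym y≡d₀)
  ... | yes _    | no  _    = contradiction (here (sym hx≡hy)) (proj₂ (proj₂ other-than-d₀))
  ... | no  _    | yes _    = contradiction (here hx≡hy) (proj₂ (proj₂ other-than-d₀))
  ... | no  x≢d₀ | no  y≢d₀ with tracked-initially x-tracked | tracked-initially y-tracked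
  ...   | inj₁ x≡d₀ | _         = contradiction x≡d₀ x≢d₀
  ...   | inj₂ _    | inj₁ y≡d₀ = contradiction y≡d₀ y≢d₀
  ...   | inj₂ x≡e  | inj₂ y≡e  = trans x≡e (sym y≡e)

  embeds-step : ∀ t → EmbedsInto X (Tracked t) (h t) → EmbedsInto X (Tracked⁺ t) (h (suc t))
  into (embeds-step t embeds) {x} x-tracked with tracked? t x
  ... | yes tracked = into embeds tracked
  ... | no  _       = proj₁ (proj₂ (outside-image (h t) t))
  injective (embeds-step t embeds) {x} {y} x-tracked y-tracked hx≡hy with tracked? t x | tracked? t y
  ... | yes x-old | yes y-old = injective embeds x-old y-old hx≡hy
  ... | yes x-old | no  _     = contradiction (subst (_∈ map (h t) (trackedList t)) hx≡hy (∈-map⁺ (h t) (trackedList-complete x-old)))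
                                              (proj₂ (proj₂ (outside-image (h t) t)))
  ... | no  _     | yes y-old = contradiction (subst (_∈ map (h t) (trackedList t)) (sym hx≡hy) (∈-map⁺ (h t) (trackedList-complete y-old)))
                                              (proj₂ (proj₂ (outside-image (h t) t)))
  ... | no  x-new | no  y-new with x-tracked | y-tracked
  ...   | inj₁ x-old | _          = contradiction x-old x-new
  ...   | inj₂ _     | inj₁ y-old = contradiction y-old y-new
  ...   | inj₂ x≡d   | inj₂ y≡d   = trans x≡d (sym y≡d)

  embeds : ∀ t → EmbedsInto X (Tracked t) (h t)
  embeds⁺ : ∀ t → EmbedsInto X (Tracked⁺ t) (h (suc t))
  embeds zero    = embeds-initially
  embeds (suc t) = record { into = λ x → into (embeds⁺ t) (tracked-step x)
                          ; injective = λ x y → injective (embeds⁺ t) (tracked-step x) (tracked-step y) }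
  embeds⁺ t = embeds-step t (embeds t)

  open Renaming d₀ A h

  compatible : ∀ {ρ} → (∀ t r → Tracked t (τ ρ t r)) → Compatible ρ u
  compatible tracked = record
    { fixes-d₀  = h-fixes-d₀
    ; persists  = λ t r → persists (tracked t r)
    ; separates = λ t r → injective (embeds⁺ t) (inj₁ (tracked t r)) (inj₂ refl)
    }

  renamed-in-X : ∀ {ρ} w → IsAcceptingRun d₀ A ρ u → (∀ t r → Tracked t (τ ρ t r))
               → (produces : Produces d₀ A ρ w)
               → Restrict X (⟦_⟧ d₀ A) (renameInput u) (renameOutput ρ (proj₁ produces) w)
  renamed-in-X {ρ} w accepting tracked produces =
      (λ t → into (embeds⁺ t) (inj₂ refl))
    , output-in-X
    , renameRun ρ , renameRun-accepting (compatible tracked) accepting , renameRun-produces w produces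
    where
    output-in-X : ∀ m → X (h (suc (step-of ρ (proj₁ produces) m)) (proj₂ (w m)))
    output-in-X m with output-in-register ρ w produces m
    ... | r , in-r = into (embeds t) (subst (Tracked t) (sym in-r) (tracked t r))
      where t = suc (step-of ρ (proj₁ produces) m)

  -- Restricted functionality forces the two outputs to agree wherever the
  -- first one carries e: the renamed outputs agree, e keeps its image, and
  -- h is injective on the values tracked when the second output is written.
  agree-at-e : Functional (Restrict X (⟦_⟧ d₀ A)) → ∀ w₁ w₂
             → Produces d₀ A ρ₁ w₁ → Produces d₀ A ρ₂ w₂
             → ∀ n → proj₂ (w₁ n) ≡ e → w₁ n ≡ w₂ n
  agree-at-e restricted w₁ w₂ produces₁ produces₂ n w₁-carries-e =
    cong₂ _,_ (cong proj₁ renamed-agree) values-agree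
    where
    open ≡-Reasoning
    t₁ t₂ : ℕ
    t₁ = step-of ρ₁ (proj₁ produces₁) n
    t₂ = step-of ρ₂ (proj₁ produces₂) n

    renamed-agree : renameOutput ρ₁ (proj₁ produces₁) w₁ n ≡ renameOutput ρ₂ (proj₁ produces₂) w₂ n
    renamed-agree = restricted (renameInput u) (renameOutput ρ₁ (proj₁ produces₁) w₁) (renameOutput ρ₂ (proj₁ produces₂) w₂)
      (renamed-in-X w₁ accepting₁ (λ t r → inj₂ (inj₁ (r , refl))) produces₁)
      (renamed-in-X w₂ accepting₂ (λ t r → inj₂ (inj₂ (r , refl))) produces₂) n

    same-image : h (suc t₂) e ≡ h (suc t₂) (proj₂ (w₂ n))
    same-image = begin
      h (suc t₂) e              ≡⟨ e-pinned (suc t₂) ⟩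
      h 0 e                     ≡⟨ e-pinned (suc t₁) ⟨
      h (suc t₁) e              ≡⟨ cong (h (suc t₁)) w₁-carries-e ⟨
      h (suc t₁) (proj₂ (w₁ n)) ≡⟨ cong proj₂ renamed-agree ⟩
      h (suc t₂) (proj₂ (w₂ n)) ∎

    w₂-tracked : Tracked (suc t₂) (proj₂ (w₂ n))
    w₂-tracked with output-in-register ρ₂ w₂ produces₂ n
    ... | r , in-r = inj₂ (inj₂ (r , sym in-r))

    values-agree : proj₂ (w₁ n) ≡ proj₂ (w₂ n)
    values-agree = trans w₁-carries-e (injective (embeds (suc t₂)) (inj₁ refl) w₂-tracked same-image)

restrict-functional : ∀ {s g} {Rel : InWord s → OutWord g → Set} (X : 𝒟 → Set)
                    → Functional Rel → Functional (Restrict X Rel)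
restrict-functional X functional u w w′ (_ , _ , related) (_ , _ , related′) =
  functional u w w′ related related′

fresh-from-size : ∀ k (X : 𝒟 → Set) → AtLeast (2 * k + 3) X
                → ∀ (L : List 𝒟) → length L ≤ 2 * k + 1 → ∃ λ y → X y × y ∉ L
fresh-from-size k X (elements , distinct , in-X) L |L|≤2k+1 =
  let (i , i∉L) = avoid elements distinct L shorter in elements i , in-X i , i∉L
  where
  shorter : length L < 2 * k + 3
  shorter = ≤-<-trans |L|≤2k+1 (+-monoʳ-< (2 * k) (s≤s (s≤s z≤n)))

theorem1 : ∀ {s g : ℕ} (d₀ : 𝒟) (A : NRT s g) → StandingAssumption d₀ A
    → (X : 𝒟 → Set) → AtLeast (2 * NRT.k A + 3) X → X d₀
    → Functional (⟦_⟧ d₀ A) ⇔ Functional (Restrict X (⟦_⟧ d₀ A))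
theorem1 d₀ A _ X large d₀∈X = mk⇔ (restrict-functional X) extend
  where
  fresh : ∀ (L : List 𝒟) → length L ≤ 2 * NRT.k A + 1 → ∃ λ y → X y × y ∉ L
  fresh = fresh-from-size (NRT.k A) X large

  extend : Functional (Restrict X (⟦_⟧ d₀ A)) → Functional (⟦_⟧ d₀ A)
  extend restricted u w₁ w₂ (_ , accepting₁ , produces₁) (_ , accepting₂ , produces₂) n =
    TwoRuns.agree-at-e d₀ A X d₀∈X fresh accepting₁ accepting₂ (proj₂ (w₁ n))
                       restricted w₁ w₂ produces₁ produces₂ n refl
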